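{- Let $A$ and $B$ be elements of a commutative ring $R$ with identity. Then for any positive integer $n$, $$\det[u_{|j-k|}(A,B)]_{1\le j,k\le n}=(-1)^{n-1}u_{n-1}\big(2A,(B+1)^2\big).$$
   Context: For elements $x,y$ of a commutative ring with identity, the Lucas sequence $(u_n(x,y))_{n\ge0}$ is defined by $u_0(x,y)=0$, $u_1(x,y)=1$, and $u_{n+1}(x,y)=xu_n(x,y)-yu_{n-1}(x,y)$ for $n\ge1$. -}

module Defs where

open import Level using (Level)
open import Algebra.Bundles using (CommutativeRing)
open import Data.Nat using (ℕ; zero; suc; ∣_-_∣)
open import Data.Fin using (Fin; zero; suc; toℕ; punchIn)

module _ {c ℓ : Level} (R : CommutativeRing c ℓ) where
  open CommutativeRing R hiding (zero)

  lucas : Carrier → Carrier → ℕ → Carrier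
  lucas x y zero = 0#
  lucas x y (suc zero) = 1#
  lucas x y (suc (suc n)) = x * lucas x y (suc n) - y * lucas x y n

  sign : ℕ → Carrier
  sign zero = 1#
  sign (suc n) = - sign n

  sumFin : (n : ℕ) → (Fin n → Carrier) → Carrier
  sumFin zero f = 0#
  sumFin (suc n) f = f zero + sumFin n (λ i → f (suc i))

  det : (n : ℕ) → (Fin n → Fin n → Carrier) → Carrier
  det zero M = 1#
  det (suc n) M =
    sumFin (suc n) (λ k → sign (toℕ k) * (M zero k *
      det n (λ i j → M (suc i) (punchIn k j))))

  lucasToeplitz : Carrier → Carrier → (n : ℕ) → Fin n → Fin n → Carrier
  lucasToeplitz a b n j k = lucas a b ∣ toℕ j - toℕ k ∣

{-# OPTIONS --safe #-}
-- Expanding along the first row twice shows that a determinant with two equal rows vanishes, so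
-- adding multiples of rows 1 and 2 to row 0 does not change it. Let X_s be the Toeplitz matrix
-- T = [u_{|j-k|}(A,B)] with its first column replaced by u_s, u_{s+1}, ... . Adding
-- -A (row 1) + B (row 2) to row 0 and using u_{m+2} = A u_{m+1} - B u_m leaves the row
-- (γ_s, B+1, 0, ..., 0), whence det X_s = γ_s det T - (B+1) det X_{s+1} one size down.
-- Induction on the size then gives det X_s = (B+1) w_k u_s + w_{k+1} u_{s+1} with
-- w_k = (-1)^k u_k(2A, (B+1)^2), and T = X_0 with u_0 = 0, u_1 = 1.
module Submission where

open import Level using (Level)
open import Algebra.Bundles using (CommutativeRing)
open import Data.Nat as ℕ using (ℕ; zero; suc)
import Data.Nat.Properties as ℕ
open import Data.Integer as ℤ using (ℤ; +_; -[1+_]; _⊖_)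
import Data.Integer.Properties as ℤ
open import Data.Fin using (Fin; zero; suc; toℕ; punchIn; lift)
open import Data.Vec.Functional using (Vector; _∷_; removeAt)
import Data.Maybe as Maybe
open import Function using (_∘_)
open import Relation.Binary.PropositionalEquality as ≡ using (_≗_)
open import Relation.Binary.Consequences using (dec⇒weaklyDec)
import Algebra.Solver.Ring
open import Algebra.Solver.Ring.AlmostCommutativeRing
  using (AlmostCommutativeRing; _-Raw-AlmostCommutative⟶_; fromCommutativeRing)
open import Defs

module IntegerCoefficientSolver {c ℓ : Level} (R : CommutativeRing c ℓ) where
  open CommutativeRing R hiding (zero)
  open import Algebra.Properties.Ring ring
    using (-0#≈0#; -‿involutive; xyx⁻¹≈y; -‿+-comm; -‿distribˡ-*; -‿distribʳ-*)
  open import Algebra.Properties.Semiring.Mult.TCOptimised semiring using (_×_; 1+×; ×-homo-+; ×1-homo-*)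
  open import Relation.Binary.Reasoning.Setoid setoid

  -- The solver compares normal forms by computation, so its coefficients must live in a ring
  -- whose arithmetic reduces. With the optimised multiple, fromℤ (+ 0) and fromℤ (+ 1) are
  -- 0# and 1# on the nose, so con (+ 0) and con (+ 1) match the literals in goals.
  fromℤ : ℤ → Carrier
  fromℤ (+ n) = n × 1#
  fromℤ -[1+ n ] = - (suc n × 1#)

  fromℤ-neg : ∀ i → fromℤ (ℤ.- i) ≈ - fromℤ i
  fromℤ-neg (+ zero) = sym -0#≈0#
  fromℤ-neg (+ suc n) = refl
  fromℤ-neg -[1+ n ] = sym (-‿involutive _)

  fromℤ-⊖ : ∀ m n → fromℤ (m ⊖ n) ≈ m × 1# - n × 1#
  fromℤ-⊖ m zero = begin
    fromℤ (m ⊖ 0) ≡⟨ ≡.cong fromℤ (ℤ.⊖-≥ {m} ℕ.z≤n) ⟩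
    m × 1# ≈⟨ +-identityʳ _ ⟨
    m × 1# + 0# ≈⟨ +-congˡ -0#≈0# ⟨
    m × 1# - 0# ∎
  fromℤ-⊖ zero (suc n) = begin
    fromℤ (0 ⊖ suc n) ≡⟨ ≡.cong fromℤ (ℤ.⊖-< {0} {suc n} ℕ.z<s) ⟩
    - (suc n × 1#) ≈⟨ +-identityˡ _ ⟨
    0# - suc n × 1# ∎
  fromℤ-⊖ (suc m) (suc n) = begin
    fromℤ (suc m ⊖ suc n) ≡⟨ ≡.cong fromℤ (ℤ.[1+m]⊖[1+n]≡m⊖n m n) ⟩
    fromℤ (m ⊖ n) ≈⟨ fromℤ-⊖ m n ⟩
    m × 1# - n × 1# ≈⟨ xyx⁻¹≈y 1# _ ⟨
    1# + (m × 1# - n × 1#) - 1# ≈⟨ +-congʳ (+-assoc 1# _ _) ⟨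
    (1# + m × 1#) - n × 1# - 1# ≈⟨ +-assoc _ _ _ ⟩
    (1# + m × 1#) + (- (n × 1#) - 1#) ≈⟨ +-congˡ (+-comm _ _) ⟩
    (1# + m × 1#) + (- 1# - n × 1#) ≈⟨ +-congˡ (-‿+-comm 1# _) ⟩
    (1# + m × 1#) - (1# + n × 1#) ≈⟨ +-cong (1+× m 1#) (-‿cong (1+× n 1#)) ⟨
    suc m × 1# - suc n × 1# ∎

  fromℤ-+ : ∀ i j → fromℤ (i ℤ.+ j) ≈ fromℤ i + fromℤ j
  fromℤ-+ (+ m) (+ n) = ×-homo-+ 1# m n
  fromℤ-+ (+ m) -[1+ n ] = fromℤ-⊖ m (suc n)
  fromℤ-+ -[1+ m ] (+ n) = trans (fromℤ-⊖ n (suc m)) (+-comm _ _)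
  fromℤ-+ -[1+ m ] -[1+ n ] = begin
    - (suc (suc m ℕ.+ n) × 1#) ≡⟨ ≡.cong (λ k → - (k × 1#)) (ℕ.+-suc (suc m) n) ⟨
    - ((suc m ℕ.+ suc n) × 1#) ≈⟨ -‿cong (×-homo-+ 1# (suc m) (suc n)) ⟩
    - (suc m × 1# + suc n × 1#) ≈⟨ -‿+-comm _ _ ⟨
    - (suc m × 1#) - suc n × 1# ∎

  fromℤ-* : ∀ i j → fromℤ (i ℤ.* j) ≈ fromℤ i * fromℤ j
  fromℤ-* (+ m) (+ n) = begin
    fromℤ (+ m ℤ.* + n) ≡⟨ ≡.cong fromℤ (ℤ.pos-* m n) ⟨
    (m ℕ.* n) × 1# ≈⟨ ×1-homo-* m n ⟩
    m × 1# * (n × 1#) ∎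
  fromℤ-* (+ m) -[1+ n ] = begin
    fromℤ (+ m ℤ.* -[1+ n ]) ≡⟨ ≡.cong fromℤ (ℤ.-◃n≡-n (m ℕ.* suc n)) ⟩
    fromℤ (ℤ.- + (m ℕ.* suc n)) ≈⟨ fromℤ-neg (+ (m ℕ.* suc n)) ⟩
    - ((m ℕ.* suc n) × 1#) ≈⟨ -‿cong (×1-homo-* m (suc n)) ⟩
    - (m × 1# * (suc n × 1#)) ≈⟨ -‿distribʳ-* _ _ ⟩
    m × 1# * - (suc n × 1#) ∎
  fromℤ-* -[1+ m ] (+ n) = begin
    fromℤ (-[1+ m ] ℤ.* + n) ≡⟨ ≡.cong fromℤ (ℤ.-◃n≡-n (suc m ℕ.* n)) ⟩
    fromℤ (ℤ.- + (suc m ℕ.* n)) ≈⟨ fromℤ-neg (+ (suc m ℕ.* n)) ⟩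
    - ((suc m ℕ.* n) × 1#) ≈⟨ -‿cong (×1-homo-* (suc m) n) ⟩
    - (suc m × 1# * (n × 1#)) ≈⟨ -‿distribˡ-* _ _ ⟩
    - (suc m × 1#) * (n × 1#) ∎
  fromℤ-* -[1+ m ] -[1+ n ] = begin
    (suc m ℕ.* suc n) × 1# ≈⟨ ×1-homo-* (suc m) (suc n) ⟩
    suc m × 1# * (suc n × 1#) ≈⟨ -‿involutive _ ⟨
    - - (suc m × 1# * (suc n × 1#)) ≈⟨ -‿cong (-‿distribˡ-* _ _) ⟩
    - (- (suc m × 1#) * (suc n × 1#)) ≈⟨ -‿distribʳ-* _ _ ⟩
    - (suc m × 1#) * - (suc n × 1#) ∎

  private
    R′ : AlmostCommutativeRing c ℓ
    R′ = fromCommutativeRing R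

  fromℤ-homomorphism : ℤ.+-*-rawRing -Raw-AlmostCommutative⟶ R′
  fromℤ-homomorphism = record
    { ⟦_⟧ = fromℤ ; +-homo = fromℤ-+ ; *-homo = fromℤ-* ; -‿homo = fromℤ-neg
    ; 0-homo = refl ; 1-homo = refl }

  open Algebra.Solver.Ring ℤ.+-*-rawRing R′ fromℤ-homomorphism
    (λ i j → Maybe.map (reflexive ∘ ≡.cong fromℤ) (dec⇒weaklyDec ℤ._≟_ i j))
    public


module Determinant {c ℓ : Level} (R : CommutativeRing c ℓ) where
  open CommutativeRing R hiding (zero)
  open import Algebra.Properties.Ring ring using (-0#≈0#; -1*x≈-x; -‿+-comm; -‿distribˡ-*; -‿distribʳ-*; +-inverseʳ-unique)
  open import Algebra.Properties.CommutativeSemigroup +-commutativeSemigroup using (interchange)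
  open IntegerCoefficientSolver R using (solve; _:+_; _:-_; _:*_; :-_; _:=_; con)
  open import Relation.Binary.Reasoning.Setoid setoid

  ∑ : (n : ℕ) → Vector Carrier n → Carrier
  ∑ = sumFin R

  sgn : ∀ {n} → Fin n → Carrier
  sgn k = sign R (toℕ k)

  ∑-cong : ∀ n {f g : Vector Carrier n} → (∀ i → f i ≈ g i) → ∑ n f ≈ ∑ n g
  ∑-cong zero    f≈g = refl
  ∑-cong (suc n) f≈g = +-cong (f≈g zero) (∑-cong n (f≈g ∘ suc))

  ∑-zero : ∀ n {f : Vector Carrier n} → (∀ i → f i ≈ 0#) → ∑ n f ≈ 0#
  ∑-zero zero    f≈0 = refl
  ∑-zero (suc n) f≈0 = trans (+-cong (f≈0 zero) (∑-zero n (f≈0 ∘ suc))) (+-identityˡ 0#)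

  ∑-distrib-+ : ∀ n (f g : Vector Carrier n) → ∑ n (λ i → f i + g i) ≈ ∑ n f + ∑ n g
  ∑-distrib-+ zero    f g = sym (+-identityˡ 0#)
  ∑-distrib-+ (suc n) f g = trans (+-congˡ (∑-distrib-+ n (f ∘ suc) (g ∘ suc))) (interchange _ _ _ _)

  *-distribˡ-∑ : ∀ n x (f : Vector Carrier n) → x * ∑ n f ≈ ∑ n (λ i → x * f i)
  *-distribˡ-∑ zero    x f = zeroʳ x
  *-distribˡ-∑ (suc n) x f = trans (distribˡ x _ _) (+-congˡ (*-distribˡ-∑ n x (f ∘ suc)))

  ∑-neg : ∀ n (f : Vector Carrier n) → ∑ n (λ i → - f i) ≈ - ∑ n f
  ∑-neg zero    f = sym -0#≈0#
  ∑-neg (suc n) f = trans (+-congˡ (∑-neg n (f ∘ suc))) (-‿+-comm _ _)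

  Matrix : ℕ → ℕ → Set c
  Matrix m n = Vector (Vector Carrier n) m

  deleteColumn : ∀ {m n} → Matrix m (suc n) → Fin (suc n) → Matrix m n
  deleteColumn N k i = removeAt (N i) k

  laplaceTerm : ∀ n → Vector Carrier (suc n) → Matrix n (suc n) → Fin (suc n) → Carrier
  laplaceTerm n v N k = sgn k * (v k * det R n (deleteColumn N k))

  det₁ : (M : Matrix 1 1) → det R 1 M ≈ M zero zero
  det₁ M = trans (+-identityʳ _) (trans (*-identityˡ _) (*-identityʳ _))

  det₂ : (M : Matrix 2 2) → det R 2 M ≈ M zero zero * M (suc zero) (suc zero) - M zero (suc zero) * M (suc zero) zero
  det₂ M = solve 4 (λ a b c d → con (+ 1) :* (a :* (con (+ 1) :* (d :* con (+ 1)) :+ con (+ 0)))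
                                  :+ (:- con (+ 1) :* (b :* (con (+ 1) :* (c :* con (+ 1)) :+ con (+ 0))) :+ con (+ 0))
                                := a :* d :- b :* c)
    refl (M zero zero) (M zero (suc zero)) (M (suc zero) zero) (M (suc zero) (suc zero))

  det-cong : ∀ n {M N : Matrix n n} → (∀ i j → M i j ≈ N i j) → det R n M ≈ det R n N
  det-cong zero    M≈N = refl
  det-cong (suc n) {M} {N} M≈N = ∑-cong (suc n) {laplaceTerm n (M zero) (M ∘ suc)} {laplaceTerm n (N zero) (N ∘ suc)} λ k →
    *-congˡ (*-cong (M≈N zero k) (det-cong n λ i j → M≈N (suc i) (punchIn k j)))

  det-+-row₀ : ∀ n (v w : Vector Carrier (suc n)) (N : Matrix n (suc n)) →
    det R (suc n) ((λ j → v j + w j) ∷ N) ≈ det R (suc n) (v ∷ N) + det R (suc n) (w ∷ N)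
  det-+-row₀ n v w N = trans
    (∑-cong (suc n) {laplaceTerm n (λ j → v j + w j) N} {λ k → laplaceTerm n v N k + laplaceTerm n w N k} λ k →
      solve 4 (λ s a b m → s :* ((a :+ b) :* m) := s :* (a :* m) :+ s :* (b :* m))
      refl (sgn k) (v k) (w k) (det R n (deleteColumn N k)))
    (∑-distrib-+ (suc n) (laplaceTerm n v N) (laplaceTerm n w N))

  det-*-row₀ : ∀ n x (v : Vector Carrier (suc n)) (N : Matrix n (suc n)) →
    det R (suc n) ((λ j → x * v j) ∷ N) ≈ x * det R (suc n) (v ∷ N)
  det-*-row₀ n x v N = trans
    (∑-cong (suc n) {laplaceTerm n (λ j → x * v j) N} {λ k → x * laplaceTerm n v N k} λ k →
      solve 4 (λ s x a m → s :* ((x :* a) :* m) := x :* (s :* (a :* m)))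
      refl (sgn k) x (v k) (det R n (deleteColumn N k)))
    (sym (*-distribˡ-∑ (suc n) x (laplaceTerm n v N)))

  det-+-row₁ : ∀ n (u v w : Vector Carrier (suc (suc n))) (N : Matrix n (suc (suc n))) →
    det R (suc (suc n)) (u ∷ (λ j → v j + w j) ∷ N)
      ≈ det R (suc (suc n)) (u ∷ v ∷ N) + det R (suc (suc n)) (u ∷ w ∷ N)
  det-+-row₁ n u v w N = trans
    (∑-cong (suc (suc n)) {laplaceTerm (suc n) u ((λ j → v j + w j) ∷ N)}
      {λ k → laplaceTerm (suc n) u (v ∷ N) k + laplaceTerm (suc n) u (w ∷ N) k} λ k → trans
      (*-congˡ (*-congˡ (det-+-row₀ n (removeAt v k) (removeAt w k) (deleteColumn N k))))
      (solve 4 (λ s a p q → s :* (a :* (p :+ q)) := s :* (a :* p) :+ s :* (a :* q)) refl (sgn k) (u k) _ _))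
    (∑-distrib-+ (suc (suc n)) (laplaceTerm (suc n) u (v ∷ N)) (laplaceTerm (suc n) u (w ∷ N)))

  -- det (v ∷ v ∷ N) is doubleLaplace n v (λ f → det n (columns f of N)). Φ is kept abstract
  -- because the induction replaces it by Φ ∘ lift 1, which is no longer of that form.
  doubleLaplace : ∀ p → Vector Carrier (suc (suc p)) → ((Fin p → Fin (suc (suc p))) → Carrier) → Carrier
  doubleLaplace p a Φ = ∑ (suc (suc p)) λ k → sgn k * (a k * ∑ (suc p) λ l →
    sgn l * (a (punchIn k l) * Φ (punchIn k ∘ punchIn l)))

  -- The terms with k = 0 or l = 0 cancel in pairs; the others form the same sum for a ∘ suc.
  doubleLaplace-step : ∀ p a Φ → (∀ {f g} → f ≗ g → Φ f ≈ Φ g) →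
    doubleLaplace (suc p) a Φ ≈ doubleLaplace p (a ∘ suc) (Φ ∘ lift 1)
  doubleLaplace-step p a Φ Φ-resp = begin
    1# * (a zero * ∑ (suc (suc p)) F) + ∑ (suc (suc p)) (λ k → - sgn k * (a (suc k) * (1# * (a zero * Φ (suc ∘ punchIn k)) + ∑ (suc p) (λ l → - sgn l * X′ k l))))
      ≈⟨ +-congˡ (∑-cong (suc (suc p)) {λ k → - sgn k * (a (suc k) * (1# * (a zero * Φ (suc ∘ punchIn k)) + ∑ (suc p) (λ l → - sgn l * X′ k l)))}
                                       {λ k → - (a zero * F k) + E k} cancel) ⟩
    1# * (a zero * ∑ (suc (suc p)) F) + ∑ (suc (suc p)) (λ k → - (a zero * F k) + E k)
      ≈⟨ +-congˡ (∑-distrib-+ (suc (suc p)) (λ k → - (a zero * F k)) E) ⟩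
    1# * (a zero * ∑ (suc (suc p)) F) + (∑ (suc (suc p)) (λ k → - (a zero * F k)) + ∑ (suc (suc p)) E)
      ≈⟨ +-congˡ (+-congʳ (trans (∑-neg (suc (suc p)) (λ k → a zero * F k)) (-‿cong (sym (*-distribˡ-∑ (suc (suc p)) (a zero) F))))) ⟩
    1# * (a zero * ∑ (suc (suc p)) F) + (- (a zero * ∑ (suc (suc p)) F) + ∑ (suc (suc p)) E)
      ≈⟨ solve 2 (λ x e → con (+ 1) :* x :+ (:- x :+ e) := e) refl (a zero * ∑ (suc (suc p)) F) (∑ (suc (suc p)) E) ⟩
    ∑ (suc (suc p)) E ∎
    where
    X′ X : Fin (suc (suc p)) → Fin (suc p) → Carrier
    X′ k l = a (suc (punchIn k l)) * Φ (punchIn (suc k) ∘ punchIn (suc l))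
    X  k l = a (suc (punchIn k l)) * Φ (lift 1 (punchIn k ∘ punchIn l))
    F E : Fin (suc (suc p)) → Carrier
    F l = sgn l * (a (suc l) * Φ (suc ∘ punchIn l))
    E k = sgn k * (a (suc k) * ∑ (suc p) (λ l → sgn l * X k l))
    cancel : ∀ k → - sgn k * (a (suc k) * (1# * (a zero * Φ (suc ∘ punchIn k)) + ∑ (suc p) (λ l → - sgn l * X′ k l)))
                   ≈ - (a zero * F k) + E k
    cancel k = begin
      - sgn k * (a (suc k) * (1# * (a zero * Φ (suc ∘ punchIn k)) + ∑ (suc p) (λ l → - sgn l * X′ k l)))
        ≈⟨ *-congˡ (*-congˡ (+-congˡ (trans
             (∑-cong (suc p) {λ l → - sgn l * X′ k l} {λ l → - (sgn l * X k l)} λ l →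
               trans (*-congˡ (*-congˡ (Φ-resp λ { zero → ≡.refl ; (suc j) → ≡.refl }))) (sym (-‿distribˡ-* _ _)))
             (∑-neg (suc p) (λ l → sgn l * X k l))))) ⟩
      - sgn k * (a (suc k) * (1# * (a zero * Φ (suc ∘ punchIn k)) + - ∑ (suc p) (λ l → sgn l * X k l)))
        ≈⟨ solve 5 (λ s x y φ g → (:- s) :* (x :* (con (+ 1) :* (y :* φ) :+ :- g)) := :- (y :* (s :* (x :* φ))) :+ s :* (x :* g))
             refl (sgn k) (a (suc k)) (a zero) (Φ (suc ∘ punchIn k)) (∑ (suc p) (λ l → sgn l * X k l)) ⟩
      - (a zero * F k) + E k ∎

  doubleLaplace≈0 : ∀ p a Φ → (∀ {f g} → f ≗ g → Φ f ≈ Φ g) → doubleLaplace p a Φ ≈ 0#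
  doubleLaplace≈0 zero a Φ Φ-resp = begin
    doubleLaplace zero a Φ
      ≈⟨ solve 4 (λ x y φ ψ → con (+ 1) :* (x :* (con (+ 1) :* (y :* φ) :+ con (+ 0)))
                                :+ ((:- con (+ 1)) :* (y :* (con (+ 1) :* (x :* ψ) :+ con (+ 0))) :+ con (+ 0))
                              := x :* y :* (φ :- ψ))
           refl (a zero) (a (suc zero)) (Φ (punchIn zero ∘ punchIn zero)) (Φ (punchIn (suc zero) ∘ punchIn zero)) ⟩
    a zero * a (suc zero) * (Φ (punchIn zero ∘ punchIn zero) - Φ (punchIn (suc zero) ∘ punchIn zero))
      ≈⟨ *-congˡ (trans (+-congˡ (-‿cong (Φ-resp λ ()))) (-‿inverseʳ _)) ⟩
    a zero * a (suc zero) * 0#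
      ≈⟨ zeroʳ _ ⟩
    0# ∎
  doubleLaplace≈0 (suc p) a Φ Φ-resp =
    trans (doubleLaplace-step p a Φ Φ-resp) (doubleLaplace≈0 p (a ∘ suc) (Φ ∘ lift 1) (Φ-resp ∘ lift-cong))
    where
    lift-cong : ∀ {m n} {f g : Fin m → Fin n} → f ≗ g → lift 1 f ≗ lift 1 g
    lift-cong f≗g zero    = ≡.refl
    lift-cong f≗g (suc j) = ≡.cong suc (f≗g j)

  det-equal-rows₀₁ : ∀ n (v : Vector Carrier (suc (suc n))) (N : Matrix n (suc (suc n))) →
    det R (suc (suc n)) (v ∷ v ∷ N) ≈ 0#
  det-equal-rows₀₁ n v N = doubleLaplace≈0 n v (λ f → det R n (λ i j → N i (f j)))
    λ f≗g → det-cong n λ i j → reflexive (≡.cong (N i) (f≗g j))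

  det-swap-rows₀₁ : ∀ n (u v : Vector Carrier (suc (suc n))) (N : Matrix n (suc (suc n))) →
    det R (suc (suc n)) (u ∷ v ∷ N) ≈ - det R (suc (suc n)) (v ∷ u ∷ N)
  det-swap-rows₀₁ n u v N = +-inverseʳ-unique (D v u) (D u v) (begin
    D v u + D u v                     ≈⟨ +-cong (+-identityˡ _) (+-identityʳ _) ⟨
    (0# + D v u) + (D u v + 0#)       ≈⟨ +-cong (+-congʳ (det-equal-rows₀₁ n v N)) (+-congˡ (det-equal-rows₀₁ n u N)) ⟨
    (D v v + D v u) + (D u v + D u u) ≈⟨ +-cong (det-+-row₁ n v v u N) (det-+-row₁ n u v u N) ⟨
    D v w + D u w                     ≈⟨ det-+-row₀ (suc n) v u (w ∷ N) ⟨
    D w w                             ≈⟨ det-equal-rows₀₁ n w N ⟩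
    0#                                ∎)
    where
    D : Vector Carrier (suc (suc n)) → Vector Carrier (suc (suc n)) → Carrier
    D x y = det R (suc (suc n)) (x ∷ y ∷ N)
    w : Vector Carrier (suc (suc n))
    w j = v j + u j

  det-swap-rows₁₂ : ∀ n (u v w : Vector Carrier (suc (suc (suc n)))) (N : Matrix n (suc (suc (suc n)))) →
    det R (suc (suc (suc n))) (u ∷ v ∷ w ∷ N) ≈ - det R (suc (suc (suc n))) (u ∷ w ∷ v ∷ N)
  det-swap-rows₁₂ n u v w N = trans
    (∑-cong (suc (suc (suc n))) {laplaceTerm (suc (suc n)) u (v ∷ w ∷ N)} {λ k → - laplaceTerm (suc (suc n)) u (w ∷ v ∷ N) k} λ k →
      trans (*-congˡ (*-congˡ (det-swap-rows₀₁ n (removeAt v k) (removeAt w k) (deleteColumn N k))))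
            (trans (*-congˡ (sym (-‿distribʳ-* _ _))) (sym (-‿distribʳ-* _ _))))
    (∑-neg (suc (suc (suc n))) (laplaceTerm (suc (suc n)) u (w ∷ v ∷ N)))

  det-equal-rows₀₂ : ∀ n (v w : Vector Carrier (suc (suc (suc n)))) (N : Matrix n (suc (suc (suc n)))) →
    det R (suc (suc (suc n))) (v ∷ w ∷ v ∷ N) ≈ 0#
  det-equal-rows₀₂ n v w N = begin
    det R (suc (suc (suc n))) (v ∷ w ∷ v ∷ N)   ≈⟨ det-swap-rows₁₂ n v w v N ⟩
    - det R (suc (suc (suc n))) (v ∷ v ∷ w ∷ N) ≈⟨ -‿cong (det-equal-rows₀₁ (suc n) v (w ∷ N)) ⟩
    - 0#                                        ≈⟨ -0#≈0# ⟩
    0#                                          ∎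

  det-add-multiple-row₀ : ∀ n x (u v : Vector Carrier (suc n)) (N : Matrix n (suc n)) →
    det R (suc n) (u ∷ N) ≈ 0# → det R (suc n) ((λ j → v j + x * u j) ∷ N) ≈ det R (suc n) (v ∷ N)
  det-add-multiple-row₀ n x u v N det≈0 = begin
    det R (suc n) ((λ j → v j + x * u j) ∷ N)                 ≈⟨ det-+-row₀ n v (λ j → x * u j) N ⟩
    det R (suc n) (v ∷ N) + det R (suc n) ((λ j → x * u j) ∷ N) ≈⟨ +-congˡ (det-*-row₀ n x u N) ⟩
    det R (suc n) (v ∷ N) + x * det R (suc n) (u ∷ N)         ≈⟨ +-congˡ (trans (*-congˡ det≈0) (zeroʳ x)) ⟩
    det R (suc n) (v ∷ N) + 0#                                ≈⟨ +-identityʳ _ ⟩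
    det R (suc n) (v ∷ N)                                     ∎

  det-row₀-supported-on-two : ∀ n (v : Vector Carrier (suc (suc n))) (N : Matrix (suc n) (suc (suc n))) →
    (∀ k → v (suc (suc k)) ≈ 0#) →
    det R (suc (suc n)) (v ∷ N)
      ≈ v zero * det R (suc n) (deleteColumn N zero) - v (suc zero) * det R (suc n) (deleteColumn N (suc zero))
  det-row₀-supported-on-two n v N v≈0 = +-cong (*-identityˡ _) (begin
    - 1# * (v (suc zero) * D₁) + ∑ n (λ k → laplaceTerm (suc n) v N (suc (suc k)))
      ≈⟨ +-congˡ (∑-zero n {λ k → laplaceTerm (suc n) v N (suc (suc k))} λ k →
           trans (*-congˡ (trans (*-congʳ (v≈0 k)) (zeroˡ _))) (zeroʳ _)) ⟩
    - 1# * (v (suc zero) * D₁) + 0#  ≈⟨ +-identityʳ _ ⟩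
    - 1# * (v (suc zero) * D₁)       ≈⟨ -1*x≈-x _ ⟩
    - (v (suc zero) * D₁)            ∎)
    where
    D₁ : Carrier
    D₁ = det R (suc n) (deleteColumn N (suc zero))

module LucasToeplitz {c ℓ : Level} (R : CommutativeRing c ℓ) (A B : CommutativeRing.Carrier R) where
  open CommutativeRing R hiding (zero)
  open Determinant R using (Matrix; deleteColumn; det₂; det-cong; det-equal-rows₀₁; det-equal-rows₀₂; det-add-multiple-row₀; det-row₀-supported-on-two)
  open IntegerCoefficientSolver R using (solve; _:+_; _:-_; _:*_; :-_; _:=_; con)
  open import Relation.Binary.Reasoning.Setoid setoid

  u : ℕ → Carrier
  u = lucas R A B

  T : (n : ℕ) → Matrix n n
  T = lucasToeplitz R A B

  shiftedToeplitz : ℕ → (n : ℕ) → Matrix n n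
  shiftedToeplitz s (suc n) i zero    = u (toℕ i ℕ.+ s)
  shiftedToeplitz s (suc n) i (suc j) = T (suc n) i (suc j)

  det-T≈det-shiftedToeplitz₀ : ∀ n → det R n (T n) ≈ det R n (shiftedToeplitz 0 n)
  det-T≈det-shiftedToeplitz₀ n = det-cong n (T≈shiftedToeplitz₀ n)
    where
    T≈shiftedToeplitz₀ : ∀ n i j → T n i j ≈ shiftedToeplitz 0 n i j
    T≈shiftedToeplitz₀ (suc n) i zero    =
      reflexive (≡.cong u (≡.trans (ℕ.∣-∣-identityʳ (toℕ i)) (≡.sym (ℕ.+-identityʳ (toℕ i)))))
    T≈shiftedToeplitz₀ (suc n) i (suc j) = refl

  lucas-recurrence : ∀ m → u (suc (suc m)) + - A * u (suc m) + B * u m ≈ 0#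
  lucas-recurrence m = solve 4 (λ a b x y → a :* x :- b :* y :+ :- a :* x :+ b :* y := con (+ 0)) refl A B (u (suc m)) (u m)

  γ : ℕ → Carrier
  γ s = u s + - A * u (suc s) + B * u (suc (suc s))

  det-shiftedToeplitz-recursion : ∀ n s →
    det R (3 ℕ.+ n) (shiftedToeplitz s (3 ℕ.+ n))
      ≈ γ s * det R (2 ℕ.+ n) (T (2 ℕ.+ n)) - (B + 1#) * det R (2 ℕ.+ n) (shiftedToeplitz (suc s) (2 ℕ.+ n))
  det-shiftedToeplitz-recursion n s = begin
    det R (3 ℕ.+ n) (r₀ ∷ N)
      ≈⟨ det-add-multiple-row₀ (2 ℕ.+ n) (- A) r₁ r₀ N (det-equal-rows₀₁ (suc n) r₁ (r₂ ∷ rest)) ⟨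
    det R (3 ℕ.+ n) ((λ j → r₀ j + - A * r₁ j) ∷ N)
      ≈⟨ det-add-multiple-row₀ (2 ℕ.+ n) B r₂ (λ j → r₀ j + - A * r₁ j) N (det-equal-rows₀₂ n r₂ r₁ rest) ⟨
    det R (3 ℕ.+ n) (reduced ∷ N)
      ≈⟨ det-row₀-supported-on-two (suc n) reduced N (lucas-recurrence ∘ toℕ) ⟩
    γ s * det R (2 ℕ.+ n) (deleteColumn N zero) - reduced (suc zero) * det R (2 ℕ.+ n) (deleteColumn N (suc zero))
      ≈⟨ +-congˡ (-‿cong (*-cong reduced₁ (det-cong (2 ℕ.+ n) minor₁))) ⟩
    γ s * det R (2 ℕ.+ n) (T (2 ℕ.+ n)) - (B + 1#) * det R (2 ℕ.+ n) (shiftedToeplitz (suc s) (2 ℕ.+ n)) ∎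
    where
    r₀ r₁ r₂ : Vector Carrier (3 ℕ.+ n)
    r₀ = shiftedToeplitz s (3 ℕ.+ n) zero
    r₁ = shiftedToeplitz s (3 ℕ.+ n) (suc zero)
    r₂ = shiftedToeplitz s (3 ℕ.+ n) (suc (suc zero))
    rest : Matrix n (3 ℕ.+ n)
    rest i = shiftedToeplitz s (3 ℕ.+ n) (suc (suc (suc i)))
    N : Matrix (2 ℕ.+ n) (3 ℕ.+ n)
    N = r₁ ∷ r₂ ∷ rest
    reduced : Vector Carrier (3 ℕ.+ n)
    reduced j = r₀ j + - A * r₁ j + B * r₂ j
    reduced₁ : reduced (suc zero) ≈ B + 1#
    reduced₁ = solve 2 (λ a b → con (+ 1) :+ :- a :* con (+ 0) :+ b :* con (+ 1) := b :+ con (+ 1)) refl A B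
    minor₁ : ∀ i j → deleteColumn N (suc zero) i j ≈ shiftedToeplitz (suc s) (2 ℕ.+ n) i j
    minor₁ zero          zero    = refl
    minor₁ (suc zero)    zero    = refl
    minor₁ (suc (suc i)) zero    = reflexive (≡.cong (λ m → u (2 ℕ.+ m)) (≡.sym (ℕ.+-suc (toℕ i) s)))
    minor₁ zero          (suc j) = refl
    minor₁ (suc zero)    (suc j) = refl
    minor₁ (suc (suc i)) (suc j) = refl

  L : ℕ → Carrier
  L = lucas R (A + A) ((B + 1#) * (B + 1#))

  w : ℕ → Carrier
  w k = sign R k * L k

  det-shiftedToeplitz : ∀ k s →
    det R (2 ℕ.+ k) (shiftedToeplitz s (2 ℕ.+ k)) ≈ (B + 1#) * w k * u s + w (suc k) * u (suc s)
  det-shiftedToeplitz zero s = trans (det₂ (shiftedToeplitz s 2))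
    (solve 3 (λ b x y → x :* con (+ 0) :- con (+ 1) :* y := (b :+ con (+ 1)) :* (con (+ 1) :* con (+ 0)) :* x :+ :- con (+ 1) :* con (+ 1) :* y)
      refl B (u s) (u (suc s)))
  det-shiftedToeplitz (suc k) s = begin
    det R (3 ℕ.+ k) (shiftedToeplitz s (3 ℕ.+ k))
      ≈⟨ det-shiftedToeplitz-recursion k s ⟩
    γ s * det R (2 ℕ.+ k) (T (2 ℕ.+ k)) - (B + 1#) * det R (2 ℕ.+ k) (shiftedToeplitz (suc s) (2 ℕ.+ k))
      ≈⟨ +-cong (*-congˡ (trans (det-T≈det-shiftedToeplitz₀ (2 ℕ.+ k)) (det-shiftedToeplitz k 0)))
                (-‿cong (*-congˡ (det-shiftedToeplitz k (suc s)))) ⟩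
    γ s * ((B + 1#) * w k * u 0 + w (suc k) * u 1)
      - (B + 1#) * ((B + 1#) * w k * u (suc s) + w (suc k) * u (suc (suc s)))
      ≈⟨ solve 7 (λ a b x y σ l l′ →
           -- the goal contains u (2 + s) and L (2 + k) unfolded by their recurrences, hence u₂ and w₂
           let c = b :+ con (+ 1); u₂ = a :* y :- b :* x
               w₀ = σ :* l; w₁ = :- σ :* l′; w₂ = :- (:- σ) :* ((a :+ a) :* l′ :- c :* c :* l)
           in (x :+ :- a :* y :+ b :* u₂) :* (c :* w₀ :* con (+ 0) :+ w₁ :* con (+ 1)) :- c :* (c :* w₀ :* y :+ w₁ :* u₂)
              := c :* w₁ :* x :+ w₂ :* y)
           refl A B (u s) (u (suc s)) (sign R k) (L k) (L (suc k)) ⟩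
    (B + 1#) * w (suc k) * u s + w (suc (suc k)) * u (suc s) ∎

corollary1p1 : {c ℓ : Level} (R : CommutativeRing c ℓ) →
    let open CommutativeRing R in
    (A B : Carrier) (m : ℕ) →
      det R (suc m) (lucasToeplitz R A B (suc m))
        ≈ sign R m * lucas R (A + A) ((B + 1#) * (B + 1#)) m
corollary1p1 R A B zero    = trans (det₁ (lucasToeplitz R A B 1)) (sym (*-identityˡ 0#))
  where open CommutativeRing R
        open Determinant R using (det₁)
corollary1p1 R A B (suc k) = begin
  det R (2 ℕ.+ k) (T (2 ℕ.+ k))                     ≈⟨ det-T≈det-shiftedToeplitz₀ (2 ℕ.+ k) ⟩
  det R (2 ℕ.+ k) (shiftedToeplitz 0 (2 ℕ.+ k))     ≈⟨ det-shiftedToeplitz k 0 ⟩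
  (B + 1#) * w k * 0# + w (suc k) * 1#              ≈⟨ +-cong (zeroʳ _) (*-identityʳ _) ⟩
  0# + w (suc k)                                    ≈⟨ +-identityˡ _ ⟩
  w (suc k)                                         ∎
  where open CommutativeRing R
        open LucasToeplitz R A B
        open import Relation.Binary.Reasoning.Setoid setoid
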